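{- Let $B_1\subseteq Q_k^{n_1}$ and $B_2\subseteq Q_k^{n_2}$. (a) If $B_1$ and $B_2$ are latin bitrades, then the Cartesian product $B_1\times B_2\subseteq Q_k^{n_1+n_2}$ is a latin bitrade. (b) If $B_1$ and $B_2$ are bipartite bitrades, then $B_1\times B_2$ is a bipartite bitrade.
   Context: Let $Q_k=\{0,1,\dots,k-1\}$ and $Q_k^n$ the set of words of length $n$ over $Q_k$. The Hamming distance $d(x,y)$ is the number of positions where $x,y$ differ; $\Gamma Q_k^n$ denotes the graph on $Q_k^n$ with edges between words at Hamming distance $1$. A one-dimensional face of direction $i$ through $(a_1,\dots,a_n)$ is $\{(a_1,\dots,a_{i-1},x,a_{i+1},\dots,a_n): x\in Q_k\}$. A set $B\subseteq Q_k^n$ is a latin bitrade if $|B\cap F|\in\{0,2\}$ for every one-dimensional face $F$. A latin bitrade $B$ is bipartite if the subgraph of $\Gamma Q_k^n$ induced by $B$ is bipartite. -}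

module Defs where

open import Data.Nat using (ℕ; zero; suc; _+_)
open import Data.Bool using (Bool; true; false; _∧_; not; if_then_else_)
open import Data.Fin using (Fin; zero; suc; _≟_)
open import Data.Vec using (Vec; lookup; _[_]≔_; take; drop)
open import Data.Product using (Σ; _×_)
open import Data.Sum using (_⊎_)
open import Relation.Nullary.Decidable using (⌊_⌋)
open import Relation.Binary.PropositionalEquality using (_≡_; _≢_)

Word : ℕ → ℕ → Set
Word k n = Vec (Fin k) n

Subset : ℕ → ℕ → Set
Subset k n = Word k n → Bool

countFin : {m : ℕ} → (Fin m → Bool) → ℕ
countFin {zero}  p = 0
countFin {suc m} p = (if p zero then 1 else 0) + countFin (λ i → p (suc i))

hamming : {k n : ℕ} → Word k n → Word k n → ℕ
hamming x y = countFin (λ i → not ⌊ lookup x i ≟ lookup y i ⌋)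

-- |B ∩ F| where F is the one-dimensional face of direction i through a;
-- the face is { a[i ≔ x] : x ∈ Q_k }, and x ↦ a[i ≔ x] is injective.
faceCount : {k n : ℕ} → Subset k n → Fin n → Word k n → ℕ
faceCount B i a = countFin (λ x → B (a [ i ]≔ x))

IsLatinBitrade : {k n : ℕ} → Subset k n → Set
IsLatinBitrade {k} {n} B =
  (i : Fin n) (a : Word k n) → (faceCount B i a ≡ 0) ⊎ (faceCount B i a ≡ 2)

InducedBipartite : {k n : ℕ} → Subset k n → Set
InducedBipartite {k} {n} B =
  Σ (Word k n → Bool) λ c →
    (x y : Word k n) → B x ≡ true → B y ≡ true → hamming x y ≡ 1 → c x ≢ c y

IsBipartiteBitrade : {k n : ℕ} → Subset k n → Set
IsBipartiteBitrade B = IsLatinBitrade B × InducedBipartite B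

_⊗_ : {k n₁ n₂ : ℕ} → Subset k n₁ → Subset k n₂ → Subset k (n₁ + n₂)
_⊗_ {n₁ = n₁} B₁ B₂ w = B₁ (take n₁ w) ∧ B₂ (drop n₁ w)

-- A one-dimensional face of Q_k^(n₁+n₂) varies a single coordinate, which lies in one of the
-- two blocks; so the face meets B₁ × B₂ either nowhere (if the fixed word of the other block
-- is outside its set) or exactly as a face of the first block meets B₁ (resp. of the second
-- meets B₂). Likewise two words of B₁ × B₂ at Hamming distance 1 agree on one block and are
-- adjacent on the other, so c(u v) = c₁(u) xor c₂(v) is a proper 2-colouring.
module Submission where

open import Defs
open import Data.Nat using (ℕ; zero; suc; _+_)
open import Data.Nat.Properties using (+-assoc)
open import Data.Product using (_×_; _,_)
open import Data.Sum using (_⊎_; inj₁; inj₂)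
open import Data.Bool using (Bool; true; false; _∧_; not; if_then_else_; _xor_)
open import Data.Bool.Properties using (∧-identityʳ; ∧-zeroʳ; xor-assoc; xor-comm; xor-same; xor-identityʳ)
open import Data.Fin using (Fin; zero; suc; _≟_; _↑ˡ_; _↑ʳ_; splitAt)
open import Data.Fin.Properties using (splitAt⁻¹-↑ˡ; splitAt⁻¹-↑ʳ)
open import Data.Vec using (Vec; []; _∷_; _[_]≔_; take; drop)
open import Relation.Nullary using (yes)
open import Relation.Nullary.Decidable using (⌊_⌋)
open import Relation.Binary.PropositionalEquality

private
  variable
    A : Set
    k m n n₁ n₂ : ℕ

countFin-cong : {p q : Fin m → Bool} → p ≗ q → countFin p ≡ countFin q
countFin-cong {zero}  p≗q = refl
countFin-cong {suc m} p≗q = cong₂ _+_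
  (cong (λ b → if b then 1 else 0) (p≗q zero))
  (countFin-cong (λ i → p≗q (suc i)))

countFin-false : ∀ m → countFin {m} (λ _ → false) ≡ 0
countFin-false zero    = refl
countFin-false (suc m) = countFin-false m

countFin-∧ʳ : (p : Fin m → Bool) (b : Bool) →
  countFin (λ x → p x ∧ b) ≡ (if b then countFin p else 0)
countFin-∧ʳ     p true  = countFin-cong (λ x → ∧-identityʳ (p x))
countFin-∧ʳ {m} p false = trans (countFin-cong (λ x → ∧-zeroʳ (p x))) (countFin-false m)

countFin-∧ˡ : (b : Bool) (p : Fin m → Bool) →
  countFin (λ x → b ∧ p x) ≡ (if b then countFin p else 0)
countFin-∧ˡ     true  p = refl
countFin-∧ˡ {m} false p = countFin-false m

take-[↑ˡ]≔ : ∀ m (w : Vec A (m + n)) (j : Fin m) x →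
  take m (w [ j ↑ˡ n ]≔ x) ≡ take m w [ j ]≔ x
take-[↑ˡ]≔ (suc m) (a ∷ w) zero    x = refl
take-[↑ˡ]≔ (suc m) (a ∷ w) (suc j) x = cong (a ∷_) (take-[↑ˡ]≔ m w j x)

drop-[↑ˡ]≔ : ∀ m (w : Vec A (m + n)) (j : Fin m) x →
  drop m (w [ j ↑ˡ n ]≔ x) ≡ drop m w
drop-[↑ˡ]≔ (suc m) (a ∷ w) zero    x = refl
drop-[↑ˡ]≔ (suc m) (a ∷ w) (suc j) x = drop-[↑ˡ]≔ m w j x

take-[↑ʳ]≔ : ∀ m (w : Vec A (m + n)) (j : Fin n) x →
  take m (w [ m ↑ʳ j ]≔ x) ≡ take m w
take-[↑ʳ]≔ zero    w       j x = refl
take-[↑ʳ]≔ (suc m) (a ∷ w) j x = cong (a ∷_) (take-[↑ʳ]≔ m w j x)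

drop-[↑ʳ]≔ : ∀ m (w : Vec A (m + n)) (j : Fin n) x →
  drop m (w [ m ↑ʳ j ]≔ x) ≡ drop m w [ j ]≔ x
drop-[↑ʳ]≔ zero    w       j x = refl
drop-[↑ʳ]≔ (suc m) (a ∷ w) j x = drop-[↑ʳ]≔ m w j x

zeroOrTwo-if : ∀ b {t : ℕ} → t ≡ 0 ⊎ t ≡ 2 →
  (if b then t else 0) ≡ 0 ⊎ (if b then t else 0) ≡ 2
zeroOrTwo-if true  t≡0∨2 = t≡0∨2
zeroOrTwo-if false _     = inj₁ refl

hamming-take-drop : ∀ m (x y : Word k (m + n)) →
  hamming x y ≡ hamming (take m x) (take m y) + hamming (drop m x) (drop m y)
hamming-take-drop zero    x       y       = refl
hamming-take-drop (suc m) (a ∷ x) (b ∷ y) = trans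
  (cong (differ +_) (hamming-take-drop m x y))
  (sym (+-assoc differ _ _))
  where differ = if not ⌊ a ≟ b ⌋ then 1 else 0

hamming≡0⇒≡ : (x y : Word k n) → hamming x y ≡ 0 → x ≡ y
hamming≡0⇒≡ []      []      _ = refl
hamming≡0⇒≡ (a ∷ x) (b ∷ y) d≡0 with a ≟ b
... | yes refl = cong (a ∷_) (hamming≡0⇒≡ x y d≡0)

m+n≡1⇒ : ∀ m {n} → m + n ≡ 1 → (m ≡ 0 × n ≡ 1) ⊎ (m ≡ 1 × n ≡ 0)
m+n≡1⇒ zero       m+n≡1 = inj₁ (refl , m+n≡1)
m+n≡1⇒ (suc zero) refl  = inj₂ (refl , refl)

adjacent-take-drop : ∀ m (x y : Word k (m + n)) → hamming x y ≡ 1 →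
  (take m x ≡ take m y × hamming (drop m x) (drop m y) ≡ 1)
  ⊎ (hamming (take m x) (take m y) ≡ 1 × drop m x ≡ drop m y)
adjacent-take-drop m x y adj with m+n≡1⇒ _ (trans (sym (hamming-take-drop m x y)) adj)
... | inj₁ (d₁≡0 , d₂≡1) = inj₁ (hamming≡0⇒≡ (take m x) (take m y) d₁≡0 , d₂≡1)
... | inj₂ (d₁≡1 , d₂≡0) = inj₂ (d₁≡1 , hamming≡0⇒≡ (drop m x) (drop m y) d₂≡0)

xor-cancelʳ : ∀ a b c → a xor c ≡ b xor c → a ≡ b
xor-cancelʳ a b c eq = begin
  a                 ≡⟨ sym (xor-identityʳ a) ⟩
  a xor false       ≡⟨ cong (a xor_) (sym (xor-same c)) ⟩
  a xor (c xor c)   ≡⟨ sym (xor-assoc a c c) ⟩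
  (a xor c) xor c   ≡⟨ cong (_xor c) eq ⟩
  (b xor c) xor c   ≡⟨ xor-assoc b c c ⟩
  b xor (c xor c)   ≡⟨ cong (b xor_) (xor-same c) ⟩
  b xor false       ≡⟨ xor-identityʳ b ⟩
  b                 ∎
  where open ≡-Reasoning

xor-cancelˡ : ∀ a b c → c xor a ≡ c xor b → a ≡ b
xor-cancelˡ a b c eq = xor-cancelʳ a b c
  (trans (xor-comm a c) (trans eq (xor-comm c b)))

∧≡true⇒ : ∀ a b → a ∧ b ≡ true → a ≡ true × b ≡ true
∧≡true⇒ true true refl = refl , refl

module _ (B₁ : Subset k n₁) (B₂ : Subset k n₂) where

  faceCount-⊗-↑ˡ : (j : Fin n₁) (w : Word k (n₁ + n₂)) →
    faceCount (B₁ ⊗ B₂) (j ↑ˡ n₂) w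
      ≡ (if B₂ (drop n₁ w) then faceCount B₁ j (take n₁ w) else 0)
  faceCount-⊗-↑ˡ j w = trans
    (countFin-cong (λ x → cong₂ _∧_ (cong B₁ (take-[↑ˡ]≔ n₁ w j x)) (cong B₂ (drop-[↑ˡ]≔ n₁ w j x))))
    (countFin-∧ʳ (λ x → B₁ (take n₁ w [ j ]≔ x)) (B₂ (drop n₁ w)))

  faceCount-⊗-↑ʳ : (j : Fin n₂) (w : Word k (n₁ + n₂)) →
    faceCount (B₁ ⊗ B₂) (n₁ ↑ʳ j) w
      ≡ (if B₁ (take n₁ w) then faceCount B₂ j (drop n₁ w) else 0)
  faceCount-⊗-↑ʳ j w = trans
    (countFin-cong (λ x → cong₂ _∧_ (cong B₁ (take-[↑ʳ]≔ n₁ w j x)) (cong B₂ (drop-[↑ʳ]≔ n₁ w j x))))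
    (countFin-∧ˡ (B₁ (take n₁ w)) (λ x → B₂ (drop n₁ w [ j ]≔ x)))

  ⊗-isLatinBitrade : IsLatinBitrade B₁ → IsLatinBitrade B₂ → IsLatinBitrade (B₁ ⊗ B₂)
  ⊗-isLatinBitrade latin₁ latin₂ i w with splitAt n₁ i in eq
  ... | inj₁ j rewrite sym (splitAt⁻¹-↑ˡ eq) | faceCount-⊗-↑ˡ j w =
    zeroOrTwo-if (B₂ (drop n₁ w)) (latin₁ j (take n₁ w))
  ... | inj₂ j rewrite sym (splitAt⁻¹-↑ʳ eq) | faceCount-⊗-↑ʳ j w =
    zeroOrTwo-if (B₁ (take n₁ w)) (latin₂ j (drop n₁ w))

  ⊗-inducedBipartite : InducedBipartite B₁ → InducedBipartite B₂ → InducedBipartite (B₁ ⊗ B₂)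
  ⊗-inducedBipartite (c₁ , proper₁) (c₂ , proper₂) = colour , proper
    where
    colour : Word k (n₁ + n₂) → Bool
    colour w = c₁ (take n₁ w) xor c₂ (drop n₁ w)

    proper : ∀ x y → (B₁ ⊗ B₂) x ≡ true → (B₁ ⊗ B₂) y ≡ true → hamming x y ≡ 1 →
      colour x ≢ colour y
    proper x y x∈ y∈ adj same
      with ∧≡true⇒ (B₁ (take n₁ x)) _ x∈ | ∧≡true⇒ (B₁ (take n₁ y)) _ y∈
         | adjacent-take-drop n₁ x y adj
    ... | x₁∈ , x₂∈ | y₁∈ , y₂∈ | inj₁ (x₁≡y₁ , adj₂) =
      proper₂ (drop n₁ x) (drop n₁ y) x₂∈ y₂∈ adj₂
        (xor-cancelˡ _ _ (c₁ (take n₁ x))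
          (trans same (cong (λ t → c₁ t xor c₂ (drop n₁ y)) (sym x₁≡y₁))))
    ... | x₁∈ , x₂∈ | y₁∈ , y₂∈ | inj₂ (adj₁ , x₂≡y₂) =
      proper₁ (take n₁ x) (take n₁ y) x₁∈ y₁∈ adj₁
        (xor-cancelʳ _ _ (c₂ (drop n₁ x))
          (trans same (cong (λ t → c₁ (take n₁ y) xor c₂ t) (sym x₂≡y₂))))

proposition4 : (k n₁ n₂ : ℕ) (B₁ : Subset k n₁) (B₂ : Subset k n₂) →
    (IsLatinBitrade B₁ → IsLatinBitrade B₂ → IsLatinBitrade (B₁ ⊗ B₂))
    × (IsBipartiteBitrade B₁ → IsBipartiteBitrade B₂ → IsBipartiteBitrade (B₁ ⊗ B₂))
proposition4 k n₁ n₂ B₁ B₂ =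
  ⊗-isLatinBitrade B₁ B₂ ,
  λ (latin₁ , bipartite₁) (latin₂ , bipartite₂) →
    ⊗-isLatinBitrade B₁ B₂ latin₁ latin₂ , ⊗-inducedBipartite B₁ B₂ bipartite₁ bipartite₂
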